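{- Let $\mathcal{A}$ be a collection of hyperplanes in $Q = S_1 \times \cdots \times S_n$, each having at least one fixed coordinate (i.e. $F(A) \neq \emptyset$ for all $A \in \mathcal{A}$). If $\sum_{k=1}^{n} w_k(B_k) < 1$, then $\mathcal{A}$ does not cover $Q$, i.e. some element of $Q$ lies on no hyperplane of $\mathcal{A}$.
   Context: Let $S_1, S_2, \ldots$ be finite sets, each of size at least $2$, fix a positive integer $n$, and write $Q_k = S_1 \times \cdots \times S_k$ for $k \ge 1$, $Q = Q_n$, and let $Q_0$ consist of the single empty tuple. A hyperplane is a set $A = Y_1 \times \cdots \times Y_n$ with $Y_j \subseteq S_j$ and $|Y_j| \in \{1, |S_j|\}$ for each $j$; its set of fixed coordinates is $F(A) = \{ j : |Y_j| = 1\}$. For a collection $\mathcal{A}$ of hyperplanes let $\mathcal{A}_k = \{A \in \mathcal{A} : \max F(A) = k\}$ and $B_k = \bigcup_{A \in \mathcal{A}_k} A$; since all members of $\mathcal{A}_k$ have fixed coordinates in $\{1,\ldots,k\}$, $B_k$ is regarded as a subset of $Q_k$ (its projection onto the first $k$ coordinates). Fix numbers $\delta_j \in [0, 1/2]$. Weights are defined inductively: $w_0$ gives the empty tuple weight $1$. For $1 \le k \le n$ and $x \in Q_{k-1}$ let $\alpha_k(x) = |\{ y \in S_k : (x,y) \in B_k\}| / |S_k|$. If $\alpha_k(x) \le \delta_k$, set $w_k(x,y) = 0$ if $(x,y) \in B_k$ and $w_k(x,y) = \frac{1}{1-\alpha_k(x)} \cdot \frac{w_{k-1}(x)}{|S_k|}$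 if $(x,y) \notin B_k$. If $\alpha_k(x) > \delta_k$, set $w_k(x,y) = \frac{\alpha_k(x) - \delta_k}{\alpha_k(x)(1-\delta_k)} \cdot \frac{w_{k-1}(x)}{|S_k|}$ if $(x,y) \in B_k$ and $w_k(x,y) = \frac{1}{1-\delta_k} \cdot \frac{w_{k-1}(x)}{|S_k|}$ if $(x,y) \notin B_k$. For $X \subseteq Q_k$, $w_k(X) = \sum_{x \in X} w_k(x)$ (so $w_k(\emptyset)=0$).
   Formalization: The numbers $\delta_j \in [0, 1/2]$ are taken to be rational. -}

module Defs where

open import Data.Nat as ℕ using (ℕ; zero; suc)
open import Data.Fin using (Fin)
open import Data.Bool using (Bool; true; false; if_then_else_; _∧_)
open import Data.Maybe using (Maybe; just; nothing)
open import Data.Unit using (⊤; tt)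
open import Data.Empty using (⊥)
open import Data.Product using (Σ; _×_; _,_)
open import Data.Bool.ListAction using (any)
open import Data.List using (List; []; _∷_; map; foldr; allFin; concatMap; filter; length; upTo)
open import Data.Integer using (+_)
open import Data.Rational using (ℚ; 0ℚ; 1ℚ; _+_; _*_; _-_; _≤ᵇ_; 1/_; ≢-nonZero)
open import Data.Rational.Properties using (_≟_)
open import Relation.Nullary using (yes; no; Dec; does)
open import Relation.Binary.PropositionalEquality using (_≡_; refl)

-- Conventions: coordinates are 0-based; coordinate j (0-based) ranges over
-- S_{j+1} = Fin (s j).  So |S_{j+1}| = s j.

-- total rational division helpers (only used where denominators are nonzero)
inv : ℚ → ℚ
inv p with p ≟ 0ℚ
... | yes _ = 0ℚ
... | no p≢0 = 1/_ p {{≢-nonZero p≢0}}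

frac : ℕ → ℕ → ℚ
frac c zero = 0ℚ
frac c (suc m) = Data.Rational._/_ (+ c) (suc m)

module _ (s : ℕ → ℕ) where

  -- Q_k = S_1 × ... × S_k, as snoc-tuples; Q_0 = {()}.
  Pt : ℕ → Set
  Pt zero = ⊤
  Pt (suc k) = Pt k × Fin (s k)

  allPts : (k : ℕ) → List (Pt k)
  allPts zero = tt ∷ []
  allPts (suc k) = concatMap (λ x → map (λ y → (x , y)) (allFin (s k))) (allPts k)

  -- A hyperplane in Q_k: each coordinate is either fixed (just a, Y_j = {a})
  -- or free (nothing, Y_j = S_j).
  Hyp : ℕ → Set
  Hyp zero = ⊤
  Hyp (suc k) = Hyp k × Maybe (Fin (s k))

  onHypᵇ : {k : ℕ} → Pt k → Hyp k → Bool
  onHypᵇ {zero} tt tt = true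
  onHypᵇ {suc k} (x , y) (h , nothing) = onHypᵇ x h
  onHypᵇ {suc k} (x , y) (h , just a) = does (Data.Fin._≟_ y a) ∧ onHypᵇ x h

  _∈H_ : {k : ℕ} → Pt k → Hyp k → Set
  x ∈H A = onHypᵇ x A ≡ true

  AllFree : {k : ℕ} → Hyp k → Set
  AllFree {zero} tt = ⊤
  AllFree {suc k} (h , nothing) = AllFree h
  AllFree {suc k} (h , just _) = ⊥

  -- strip A = (max F(A) , projection of A onto the first max F(A) coordinates)
  -- (max F(A) is taken to be 0 when F(A) = ∅).
  strip : {k : ℕ} → Hyp k → Σ ℕ Hyp
  strip {zero} tt = (0 , tt)
  strip {suc k} (h , nothing) = strip h
  strip {suc k} (h , just a) = (suc k , (h , just a))

  module _ {n : ℕ} (𝒜 : List (Hyp n)) (δ : ℕ → ℚ) where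
    -- δ j is δ_{j+1}

    inCore : (k : ℕ) → Pt k → Σ ℕ Hyp → Bool
    inCore k x (m , P) with m ℕ.≟ k
    ... | yes refl = onHypᵇ x P
    ... | no _ = false

    -- membership in B_k ⊆ Q_k (union of members of 𝒜_k, projected to Q_k)
    inB : (k : ℕ) → Pt k → Bool
    inB k x = any (λ A → inCore k x (strip A)) 𝒜

    -- α_{j+1}(x) for x ∈ Q_j
    α : (j : ℕ) → Pt j → ℚ
    α j x = frac (length (filter (λ y → Data.Bool._≟_ (inB (suc j) (x , y)) true) (allFin (s j)))) (s j)

    w : (k : ℕ) → Pt k → ℚ
    w zero tt = 1ℚ
    w (suc j) (x , y) =
      let a = α j x
          d = δ j
          base = w j x * frac 1 (s j)
      in if a ≤ᵇ d
         then (if inB (suc j) (x , y) then 0ℚ else inv (1ℚ - a) * base)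
         else (if inB (suc j) (x , y)
               then ((a - d) * inv (a * (1ℚ - d))) * base
               else inv (1ℚ - d) * base)

    sumℚ : List ℚ → ℚ
    sumℚ = foldr _+_ 0ℚ

    wB : (k : ℕ) → ℚ
    wB k = sumℚ (map (λ x → if inB k x then w k x else 0ℚ) (allPts k))

    totalWeight : ℚ
    totalWeight = sumℚ (map (λ j → wB (suc j)) (upTo n))

{-# OPTIONS --safe #-}
-- The weights grow a probability distribution one coordinate at a time: w_k(x , ·) is
-- nonnegative and sums to w_{k-1}(x) over every fibre, the two cases of the definition
-- being balanced exactly so that this holds when 0 ≤ δ_k < 1.  Call x ∈ Q_k avoiding if
-- no prefix (x_1, …, x_j) of x lies in B_j.  Whatever weight the avoiding points of Q_k
-- lose at step k + 1 sits on B_{k+1}, so 1 ≤ w_k(avoiding points) + Σ_{j ≤ k} w_j(B_j).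
-- Hence if Σ_k w_k(B_k) < 1 some x ∈ Q is avoiding, and x lies on no A ∈ 𝒜: with
-- m = max F(A), the prefix of x of length m would lie in B_m.
module Submission where

open import Defs
open import Data.Nat using (ℕ; _≤_)
open import Data.Rational using (ℚ; 0ℚ; 1ℚ; ½) renaming (_≤_ to _≤ℚ_; _<_ to _<ℚ_)
open import Data.List using (List)
open import Data.List.Membership.Propositional using (_∈_)
open import Data.Product using (Σ; _×_)
open import Relation.Nullary using (¬_)

open import Level using (0ℓ)
open import Function using (_∘_; Equivalence)
open import Algebra.Bundles using (CommutativeMonoid)
open import Data.Bool as Bool using (Bool; true; false; T; if_then_else_; not; _∧_)
import Data.Bool.Properties as Bool
open import Data.Fin using (Fin)
open import Data.Integer as ℤ using () renaming (+_ to pos)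
import Data.Integer.Properties as ℤ
open import Data.Integer.Tactic.RingSolver using () renaming (solve-∀ to ℤ-solve-∀)
open import Data.List using ([]; _∷_; _++_; [_]; map; foldr; concatMap; filter; length; allFin; upTo)
import Data.List.Properties as List
open import Data.List.Membership.Propositional using (lose)
open import Data.List.Relation.Unary.Any.Properties using (any⁺)
open import Data.Maybe using (just; nothing)
open import Data.Nat as ℕ using (zero; suc; NonZero)
import Data.Nat.Properties as ℕ
open import Data.Product using (_,_; ∃; proj₁; proj₂)
open import Data.Rational as ℚ using (_+_; _*_; _-_; _≤ᵇ_)
import Data.Rational.Properties as ℚ
open import Data.Rational.Unnormalised as ℚᵘ using (mkℚᵘ; *≡*)
import Data.Rational.Unnormalised.Properties as ℚᵘ
open import Data.Unit using (tt)
open import Relation.Binary.PropositionalEquality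
  using (_≡_; refl; sym; trans; cong; cong₂; subst; module ≡-Reasoning)
open import Relation.Nullary using (yes; no; contradiction)
open import Relation.Nullary.Decidable using (dec⇒maybe; toWitness)
import Tactic.RingSolver as RingSolver
import Tactic.RingSolver.Core.AlmostCommutativeRing as ACR
open import Algebra.Properties.CommutativeSemigroup
  (CommutativeMonoid.commutativeSemigroup ℚ.*-1-commutativeMonoid) using (x∙yz≈y∙xz)

ℚ-ring : ACR.AlmostCommutativeRing 0ℓ 0ℓ
ℚ-ring = ACR.fromCommutativeRing ℚ.+-*-commutativeRing (λ p → dec⇒maybe (0ℚ ℚ.≟ p))

0≤1 : 0ℚ ≤ℚ 1ℚ
0≤1 = toWitness {a? = 0ℚ ℚ.≤? 1ℚ} tt

½<1 : ½ <ℚ 1ℚ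
½<1 = toWitness {a? = ½ ℚ.<? 1ℚ} tt

p<q⇒0<q-p : ∀ {p q} → p <ℚ q → 0ℚ <ℚ q - p
p<q⇒0<q-p {p} {q} p<q = subst (_<ℚ q - p) (ℚ.+-inverseʳ p) (ℚ.+-monoˡ-< (ℚ.- p) p<q)

+-nonNeg : ∀ {p q} → 0ℚ ≤ℚ p → 0ℚ ≤ℚ q → 0ℚ ≤ℚ p + q
+-nonNeg = ℚ.+-mono-≤

*-nonNeg : ∀ {p q} → 0ℚ ≤ℚ p → 0ℚ ≤ℚ q → 0ℚ ≤ℚ p * q
*-nonNeg {p} {q} 0≤p 0≤q =
  ℚ.nonNegative⁻¹ _ {{ℚ.nonNeg*nonNeg⇒nonNeg p {{ℚ.nonNegative 0≤p}} q {{ℚ.nonNegative 0≤q}}}}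

if-nonNeg : ∀ b {p} → 0ℚ ≤ℚ p → 0ℚ ≤ℚ (if b then p else 0ℚ)
if-nonNeg true  0≤p = 0≤p
if-nonNeg false _   = ℚ.≤-refl

if-not+if : ∀ b p → (if not b then p else 0ℚ) + (if b then p else 0ℚ) ≡ p
if-not+if true  p = ℚ.+-identityˡ p
if-not+if false p = ℚ.+-identityʳ p

if-pos⇒true : ∀ b {p} → 0ℚ <ℚ (if b then p else 0ℚ) → b ≡ true
if-pos⇒true true  _   = refl
if-pos⇒true false 0<0 = contradiction 0<0 (ℚ.<-irrefl refl)

1≤p+q⇒q<1⇒0<p : ∀ {p q} → 1ℚ ≤ℚ p + q → q <ℚ 1ℚ → 0ℚ <ℚ p
1≤p+q⇒q<1⇒0<p {p} {q} 1≤p+q q<1 = ℚ.≰⇒> λ p≤0 → ℚ.<-irrefl refl (begin-strict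
  1ℚ      ≤⟨ 1≤p+q ⟩
  p + q   ≤⟨ ℚ.+-monoˡ-≤ q p≤0 ⟩
  0ℚ + q  ≡⟨ ℚ.+-identityˡ q ⟩
  q       <⟨ q<1 ⟩
  1ℚ      ∎)
  where open ℚ.≤-Reasoning

≤ᵇ-true⇒≤ : ∀ {p q} → (p ≤ᵇ q) ≡ true → p ≤ℚ q
≤ᵇ-true⇒≤ p≤ᵇq = ℚ.≤ᵇ⇒≤ (subst T (sym p≤ᵇq) tt)

≤ᵇ-false⇒> : ∀ {p q} → (p ≤ᵇ q) ≡ false → q <ℚ p
≤ᵇ-false⇒> p≰ᵇq = ℚ.≰⇒> (λ p≤q → subst T p≰ᵇq (ℚ.≤⇒≤ᵇ p≤q))

inv-nonNeg : ∀ {p} → 0ℚ ≤ℚ p → 0ℚ ≤ℚ inv p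
inv-nonNeg {p} 0≤p with p ℚ.≟ 0ℚ
... | yes _  = ℚ.≤-refl
... | no p≢0 = ℚ.<⇒≤ (ℚ.positive⁻¹ _
  {{ℚ.1/pos⇒pos p {{ℚ.nonNeg∧nonZero⇒pos p {{ℚ.nonNegative 0≤p}} {{ℚ.≢-nonZero p≢0}}}}}})

inv-inverseʳ : ∀ {p} → 0ℚ <ℚ p → p * inv p ≡ 1ℚ
inv-inverseʳ {p} 0<p with p ℚ.≟ 0ℚ
... | yes p≡0 = contradiction (sym p≡0) (ℚ.<⇒≢ 0<p)
... | no p≢0  = ℚ.*-inverseʳ p {{ℚ.≢-nonZero p≢0}}

frac-zero : ∀ m → frac 0 m ≡ 0ℚ
frac-zero zero    = refl
frac-zero (suc m) = ℚ.0/n≡0 (suc m)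

frac-+ : ∀ a b m → frac (a ℕ.+ b) m ≡ frac a m + frac b m
frac-+ a b zero    = refl
frac-+ a b (suc m) = ℚ.toℚᵘ-injective (begin
  ℚ.toℚᵘ (frac (a ℕ.+ b) (suc m))                      ≈⟨ ℚ.toℚᵘ-fromℚᵘ (mkℚᵘ (pos (a ℕ.+ b)) m) ⟩
  mkℚᵘ (pos (a ℕ.+ b)) m                              ≈⟨ *≡* numerators ⟩
  mkℚᵘ (pos a) m ℚᵘ.+ mkℚᵘ (pos b) m                   ≈⟨ ℚᵘ.+-cong (ℚ.toℚᵘ-fromℚᵘ (mkℚᵘ (pos a) m))
                                                                    (ℚ.toℚᵘ-fromℚᵘ (mkℚᵘ (pos b) m)) ⟨
  ℚ.toℚᵘ (frac a (suc m)) ℚᵘ.+ ℚ.toℚᵘ (frac b (suc m)) ≈⟨ ℚ.toℚᵘ-homo-+ (frac a (suc m)) (frac b (suc m)) ⟨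
  ℚ.toℚᵘ (frac a (suc m) + frac b (suc m))             ∎)
  where
  open ℚᵘ.≃-Reasoning
  distrib : ∀ i j d → (i ℤ.+ j) ℤ.* (d ℤ.* d) ≡ (i ℤ.* d ℤ.+ j ℤ.* d) ℤ.* d
  distrib = ℤ-solve-∀
  numerators : pos (a ℕ.+ b) ℤ.* (pos (suc m) ℤ.* pos (suc m))
             ≡ (pos a ℤ.* pos (suc m) ℤ.+ pos b ℤ.* pos (suc m)) ℤ.* pos (suc m)
  numerators = trans (cong (ℤ._* (pos (suc m) ℤ.* pos (suc m))) (ℤ.pos-+ a b)) (distrib (pos a) (pos b) (pos (suc m)))

frac-self : ∀ m .{{_ : NonZero m}} → frac m m ≡ 1ℚ
frac-self (suc m) = ℚ.toℚᵘ-injective (ℚᵘ.≃-trans (ℚ.toℚᵘ-fromℚᵘ (mkℚᵘ (pos (suc m)) m))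
  (*≡* (trans (ℤ.*-identityʳ (pos (suc m))) (sym (ℤ.*-identityˡ (pos (suc m)))))))

frac-nonNeg : ∀ c m → 0ℚ ≤ℚ frac c m
frac-nonNeg c zero    = ℚ.≤-refl
frac-nonNeg c (suc m) = ℚ.nonNegative⁻¹ _ {{ℚ.normalize-nonNeg c (suc m)}}

stepFactor : Bool → ℚ → ℚ → ℚ
stepFactor b a d =
  if a ≤ᵇ d then (if b then 0ℚ else inv (1ℚ - a))
            else (if b then (a - d) * inv (a * (1ℚ - d)) else inv (1ℚ - d))

module _ {d : ℚ} (0≤d : 0ℚ ≤ℚ d) (d<1 : d <ℚ 1ℚ) where

  stepFactor-nonNeg : ∀ b a → 0ℚ ≤ℚ stepFactor b a d
  stepFactor-nonNeg true a with a ≤ᵇ d in a≤ᵇd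
  ... | true  = ℚ.≤-refl
  ... | false = *-nonNeg (ℚ.<⇒≤ (p<q⇒0<q-p d<a))
                         (inv-nonNeg (*-nonNeg (ℚ.<⇒≤ (ℚ.≤-<-trans 0≤d d<a)) (ℚ.<⇒≤ (p<q⇒0<q-p d<1))))
    where
    d<a : d <ℚ a
    d<a = ≤ᵇ-false⇒> {a} {d} a≤ᵇd
  stepFactor-nonNeg false a with a ≤ᵇ d in a≤ᵇd
  ... | true  = inv-nonNeg (ℚ.<⇒≤ (p<q⇒0<q-p (ℚ.≤-<-trans (≤ᵇ-true⇒≤ {a} {d} a≤ᵇd) d<1)))
  ... | false = inv-nonNeg (ℚ.<⇒≤ (p<q⇒0<q-p d<1))

  stepFactor-balance : ∀ a → a * stepFactor true a d + (1ℚ - a) * stepFactor false a d ≡ 1ℚ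
  stepFactor-balance a with a ≤ᵇ d in a≤ᵇd
  ... | true  = begin
    a * 0ℚ + (1ℚ - a) * inv (1ℚ - a) ≡⟨ cong (_+ (1ℚ - a) * inv (1ℚ - a)) (ℚ.*-zeroʳ a) ⟩
    0ℚ + (1ℚ - a) * inv (1ℚ - a)     ≡⟨ ℚ.+-identityˡ _ ⟩
    (1ℚ - a) * inv (1ℚ - a)          ≡⟨ inv-inverseʳ (p<q⇒0<q-p (ℚ.≤-<-trans (≤ᵇ-true⇒≤ {a} {d} a≤ᵇd) d<1)) ⟩
    1ℚ                               ∎
    where open ≡-Reasoning
  ... | false = begin
    a * ((a - d) * I) + (1ℚ - a) * J ≡⟨ cong (_+ (1ℚ - a) * J) (x∙yz≈y∙xz a (a - d) I) ⟩
    (a - d) * (a * I) + (1ℚ - a) * J ≡⟨ cong (λ t → (a - d) * t + (1ℚ - a) * J) a*I≡J ⟩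
    (a - d) * J + (1ℚ - a) * J       ≡⟨ telescope a d J ⟩
    (1ℚ - d) * J                     ≡⟨ inv-inverseʳ 0<1-d ⟩
    1ℚ                               ∎
    where
    open ≡-Reasoning
    I J : ℚ
    I = inv (a * (1ℚ - d))
    J = inv (1ℚ - d)
    0<1-d : 0ℚ <ℚ 1ℚ - d
    0<1-d = p<q⇒0<q-p d<1
    0<a[1-d] : 0ℚ <ℚ a * (1ℚ - d)
    0<a[1-d] = ℚ.positive⁻¹ _ {{ℚ.pos*pos⇒pos a {{ℚ.positive (ℚ.≤-<-trans 0≤d (≤ᵇ-false⇒> {a} {d} a≤ᵇd))}}
                                                  (1ℚ - d) {{ℚ.positive 0<1-d}}}}
    telescope : ∀ x y z → (x - y) * z + (1ℚ - x) * z ≡ (1ℚ - y) * z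
    telescope = RingSolver.solve-∀ ℚ-ring
    regroup : ∀ x y z w → x * z * (y * w) ≡ x * y * z * w
    regroup = RingSolver.solve-∀ ℚ-ring
    a*I≡J : a * I ≡ J
    a*I≡J = begin
      a * I                    ≡⟨ ℚ.*-identityʳ (a * I) ⟨
      a * I * 1ℚ               ≡⟨ cong (a * I *_) (inv-inverseʳ 0<1-d) ⟨
      a * I * ((1ℚ - d) * J)   ≡⟨ regroup a (1ℚ - d) I J ⟩
      a * (1ℚ - d) * I * J     ≡⟨ cong (_* J) (inv-inverseʳ 0<a[1-d]) ⟩
      1ℚ * J                   ≡⟨ ℚ.*-identityˡ J ⟩
      J                        ∎

sumOver : ∀ {A : Set} → List A → (A → ℚ) → ℚ
sumOver xs f = foldr _+_ 0ℚ (map f xs)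

syntax sumOver xs (λ x → e) = ∑[ x ∈ xs ] e

module _ {A : Set} where

  ∑-cong : ∀ {f g : A → ℚ} (xs : List A) → (∀ x → f x ≡ g x) → sumOver xs f ≡ sumOver xs g
  ∑-cong xs f≗g = cong (foldr _+_ 0ℚ) (List.map-cong f≗g xs)

  ∑-++ : ∀ (f : A → ℚ) xs ys → sumOver (xs ++ ys) f ≡ sumOver xs f + sumOver ys f
  ∑-++ f []       ys = sym (ℚ.+-identityˡ (sumOver ys f))
  ∑-++ f (x ∷ xs) ys = trans (cong (f x +_) (∑-++ f xs ys)) (sym (ℚ.+-assoc (f x) _ _))

  ∑-+ : ∀ (f g : A → ℚ) xs → ∑[ x ∈ xs ] (f x + g x) ≡ sumOver xs f + sumOver xs g
  ∑-+ f g []       = refl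
  ∑-+ f g (x ∷ xs) = trans (cong (f x + g x +_) (∑-+ f g xs)) (interchange (f x) (g x) _ _)
    where
    interchange : ∀ a b c d → a + b + (c + d) ≡ a + c + (b + d)
    interchange = RingSolver.solve-∀ ℚ-ring

  ∑-*ˡ : ∀ c (f : A → ℚ) xs → ∑[ x ∈ xs ] (c * f x) ≡ c * sumOver xs f
  ∑-*ˡ c f []       = sym (ℚ.*-zeroʳ c)
  ∑-*ˡ c f (x ∷ xs) = trans (cong (c * f x +_) (∑-*ˡ c f xs)) (sym (ℚ.*-distribˡ-+ c (f x) _))

  ∑-mono-≤ : ∀ {f g : A → ℚ} xs → (∀ x → f x ≤ℚ g x) → sumOver xs f ≤ℚ sumOver xs g
  ∑-mono-≤ []       f≤g = ℚ.≤-refl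
  ∑-mono-≤ (x ∷ xs) f≤g = ℚ.+-mono-≤ (f≤g x) (∑-mono-≤ xs f≤g)

  ∑-nonNeg : ∀ {f : A → ℚ} xs → (∀ x → 0ℚ ≤ℚ f x) → 0ℚ ≤ℚ sumOver xs f
  ∑-nonNeg []       0≤f = ℚ.≤-refl
  ∑-nonNeg (x ∷ xs) 0≤f = +-nonNeg (0≤f x) (∑-nonNeg xs 0≤f)

  ∑-pos⇒∃-pos : ∀ {f : A → ℚ} xs → 0ℚ <ℚ sumOver xs f → ∃ λ x → 0ℚ <ℚ f x
  ∑-pos⇒∃-pos []       0<0 = contradiction 0<0 (ℚ.<-irrefl refl)
  ∑-pos⇒∃-pos {f} (x ∷ xs) 0<∑ with 0ℚ ℚ.<? f x
  ... | yes 0<fx = x , 0<fx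
  ... | no  0≮fx = ∑-pos⇒∃-pos xs (ℚ.<-≤-trans 0<∑ (subst (f x + sumOver xs f ≤ℚ_) (ℚ.+-identityˡ _)
                                                    (ℚ.+-monoˡ-≤ (sumOver xs f) (ℚ.≮⇒≥ 0≮fx))))

  ∑-concatMap : ∀ (f : A → ℚ) {B : Set} (g : B → List A) ys →
                sumOver (concatMap g ys) f ≡ ∑[ y ∈ ys ] sumOver (g y) f
  ∑-concatMap f g []       = refl
  ∑-concatMap f g (y ∷ ys) = trans (∑-++ f (g y) (concatMap g ys)) (cong (sumOver (g y) f +_) (∑-concatMap f g ys))

  ∑-map : ∀ {B : Set} (f : A → ℚ) (h : B → A) ys → sumOver (map h ys) f ≡ sumOver ys (f ∘ h)
  ∑-map f h ys = cong (foldr _+_ 0ℚ) (sym (List.map-∘ ys))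

  count : (A → Bool) → List A → ℕ
  count g xs = length (filter (λ x → g x Bool.≟ true) xs)

  ∑-select : ∀ (g : A → Bool) (h : Bool → ℚ) m xs →
             ∑[ x ∈ xs ] (h (g x) * frac 1 m)
               ≡ frac (count g xs) m * h true + (frac (length xs) m - frac (count g xs) m) * h false
  ∑-select g h m [] = begin
    0ℚ                                              ≡⟨ vanish (h true) (h false) ⟨
    0ℚ * h true + (0ℚ - 0ℚ) * h false                ≡⟨ cong (λ z → z * h true + (z - z) * h false) (frac-zero m) ⟨
    frac 0 m * h true + (frac 0 m - frac 0 m) * h false ∎
    where
    open ≡-Reasoning
    vanish : ∀ t u → 0ℚ * t + (0ℚ - 0ℚ) * u ≡ 0ℚ
    vanish = RingSolver.solve-∀ ℚ-ring
  ∑-select g h m (x ∷ xs) with g x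
  ... | true  = begin
    h true * f + ∑[ x ∈ xs ] (h (g x) * f)
      ≡⟨ cong (h true * f +_) (∑-select g h m xs) ⟩
    h true * f + (c * h true + (l - c) * h false)
      ≡⟨ shift f c l (h true) (h false) ⟩
    (f + c) * h true + ((f + l) - (f + c)) * h false
      ≡⟨ cong₂ (λ c′ l′ → c′ * h true + (l′ - c′) * h false) (frac-+ 1 (count g xs) m) (frac-+ 1 (length xs) m) ⟨
    frac (suc (count g xs)) m * h true + (frac (suc (length xs)) m - frac (suc (count g xs)) m) * h false ∎
    where
    open ≡-Reasoning
    f c l : ℚ
    f = frac 1 m
    c = frac (count g xs) m
    l = frac (length xs) m
    shift : ∀ f c l t u → t * f + (c * t + (l - c) * u) ≡ (f + c) * t + ((f + l) - (f + c)) * u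
    shift = RingSolver.solve-∀ ℚ-ring
  ... | false = begin
    h false * f + ∑[ x ∈ xs ] (h (g x) * f)
      ≡⟨ cong (h false * f +_) (∑-select g h m xs) ⟩
    h false * f + (c * h true + (l - c) * h false)
      ≡⟨ absorb f c l (h true) (h false) ⟩
    c * h true + ((f + l) - c) * h false
      ≡⟨ cong (λ l′ → c * h true + (l′ - c) * h false) (frac-+ 1 (length xs) m) ⟨
    c * h true + (frac (suc (length xs)) m - c) * h false ∎
    where
    open ≡-Reasoning
    f c l : ℚ
    f = frac 1 m
    c = frac (count g xs) m
    l = frac (length xs) m
    absorb : ∀ f c l t u → u * f + (c * t + (l - c) * u) ≡ c * t + ((f + l) - c) * u
    absorb = RingSolver.solve-∀ ℚ-ring

∑-upTo-suc : ∀ (f : ℕ → ℚ) k → sumOver (upTo (suc k)) f ≡ sumOver (upTo k) f + f k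
∑-upTo-suc f k = begin
  sumOver (upTo (suc k)) f        ≡⟨ cong (λ ks → sumOver ks f) (List.upTo-∷ʳ k) ⟨
  sumOver (upTo k ++ [ k ]) f     ≡⟨ ∑-++ f (upTo k) [ k ] ⟩
  sumOver (upTo k) f + (f k + 0ℚ) ≡⟨ cong (sumOver (upTo k) f +_) (ℚ.+-identityʳ (f k)) ⟩
  sumOver (upTo k) f + f k        ∎
  where open ≡-Reasoning

∑-allPts-suc : ∀ s k (f : Pt s (suc k) → ℚ) →
               sumOver (allPts s (suc k)) f ≡ ∑[ x ∈ allPts s k ] ∑[ y ∈ allFin (s k) ] f (x , y)
∑-allPts-suc s k f = trans (∑-concatMap f (λ x → map (x ,_) (allFin (s k))) (allPts s k))
                           (∑-cong (allPts s k) (λ x → ∑-map f (x ,_) (allFin (s k))))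

module Weights (s : ℕ → ℕ) {n : ℕ} (𝒜 : List (Hyp s n)) (δ : ℕ → ℚ)
               (0≤δ : ∀ j → 0ℚ ≤ℚ δ j) (δ<1 : ∀ j → δ j <ℚ 1ℚ) where

  weight : (k : ℕ) → Pt s k → ℚ
  weight = w s 𝒜 δ

  onB : (k : ℕ) → Pt s k → Bool
  onB = inB s 𝒜 δ

  density : (j : ℕ) → Pt s j → ℚ
  density = α s 𝒜 δ

  weight-suc : ∀ j x y → weight (suc j) (x , y)
                         ≡ weight j x * (stepFactor (onB (suc j) (x , y)) (density j x) (δ j) * frac 1 (s j))
  weight-suc j x y with density j x ≤ᵇ δ j | onB (suc j) (x , y)
  ... | true  | true  = sym (trans (cong (weight j x *_) (ℚ.*-zeroˡ (frac 1 (s j)))) (ℚ.*-zeroʳ (weight j x)))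
  ... | true  | false = x∙yz≈y∙xz (inv (1ℚ - density j x)) (weight j x) (frac 1 (s j))
  ... | false | true  = x∙yz≈y∙xz ((density j x - δ j) * inv (density j x * (1ℚ - δ j))) (weight j x) (frac 1 (s j))
  ... | false | false = x∙yz≈y∙xz (inv (1ℚ - δ j)) (weight j x) (frac 1 (s j))

  weight-nonNeg : ∀ k x → 0ℚ ≤ℚ weight k x
  weight-nonNeg zero    tt      = 0≤1
  weight-nonNeg (suc j) (x , y) = subst (0ℚ ≤ℚ_) (sym (weight-suc j x y))
    (*-nonNeg (weight-nonNeg j x)
              (*-nonNeg (stepFactor-nonNeg (0≤δ j) (δ<1 j) (onB (suc j) (x , y)) (density j x)) (frac-nonNeg 1 (s j))))

  avoidsB : (k : ℕ) → Pt s k → Bool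
  avoidsB zero    tt      = true
  avoidsB (suc k) (x , y) = avoidsB k x ∧ not (onB (suc k) (x , y))

  avoidingWeight onBWeight : (k : ℕ) → Pt s k → ℚ
  avoidingWeight k x = if avoidsB k x then weight k x else 0ℚ
  onBWeight      k x = if onB k x then weight k x else 0ℚ

  avoidMass : ℕ → ℚ
  avoidMass k = sumOver (allPts s k) (avoidingWeight k)

  module _ (s≢0 : ∀ j → NonZero (s j)) where

    weight-fibre-sum : ∀ j x → ∑[ y ∈ allFin (s j) ] weight (suc j) (x , y) ≡ weight j x
    weight-fibre-sum j x = begin
      ∑[ y ∈ Sⱼ ] weight (suc j) (x , y)                         ≡⟨ ∑-cong Sⱼ (weight-suc j x) ⟩
      ∑[ y ∈ Sⱼ ] (weight j x * (φ (onB (suc j) (x , y)) * frac 1 (s j)))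
                                                               ≡⟨ ∑-*ˡ (weight j x) _ Sⱼ ⟩
      weight j x * ∑[ y ∈ Sⱼ ] (φ (onB (suc j) (x , y)) * frac 1 (s j))
                                                               ≡⟨ cong (weight j x *_) (∑-select _ φ (s j) Sⱼ) ⟩
      weight j x * (a * φ true + (frac (length Sⱼ) (s j) - a) * φ false)
                                                               ≡⟨ cong (λ t → weight j x * (a * φ true + (t - a) * φ false))
                                                                       |Sⱼ|/|Sⱼ|≡1 ⟩
      weight j x * (a * φ true + (1ℚ - a) * φ false)           ≡⟨ cong (weight j x *_)
                                                                       (stepFactor-balance (0≤δ j) (δ<1 j) a) ⟩
      weight j x * 1ℚ                                          ≡⟨ ℚ.*-identityʳ (weight j x) ⟩
      weight j x                                               ∎
      where
      open ≡-Reasoning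
      Sⱼ : List (Fin (s j))
      Sⱼ = allFin (s j)
      a : ℚ
      a = density j x
      φ : Bool → ℚ
      φ b = stepFactor b a (δ j)
      |Sⱼ|/|Sⱼ|≡1 : frac (length Sⱼ) (s j) ≡ 1ℚ
      |Sⱼ|/|Sⱼ|≡1 = trans (cong (λ l → frac l (s j)) (List.length-tabulate (λ i → i))) (frac-self (s j) {{s≢0 j}})

    avoidingWeight-fibre : ∀ k x → avoidingWeight k x ≤ℚ ∑[ y ∈ allFin (s k) ] avoidingWeight (suc k) (x , y)
                                                          + ∑[ y ∈ allFin (s k) ] onBWeight (suc k) (x , y)
    avoidingWeight-fibre k x = split (avoidsB k x)
      where
      Sₖ : List (Fin (s k))
      Sₖ = allFin (s k)
      split : ∀ c → (if c then weight k x else 0ℚ)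
                    ≤ℚ ∑[ y ∈ Sₖ ] (if c ∧ not (onB (suc k) (x , y)) then weight (suc k) (x , y) else 0ℚ)
                     + ∑[ y ∈ Sₖ ] onBWeight (suc k) (x , y)
      split true  = ℚ.≤-reflexive (begin
        weight k x                                                     ≡⟨ weight-fibre-sum k x ⟨
        ∑[ y ∈ Sₖ ] weight (suc k) (x , y)                             ≡⟨ ∑-cong Sₖ (λ y → if-not+if (onB (suc k) (x , y)) _) ⟨
        ∑[ y ∈ Sₖ ] ((if not (onB (suc k) (x , y)) then weight (suc k) (x , y) else 0ℚ) + onBWeight (suc k) (x , y))
                                                                       ≡⟨ ∑-+ _ _ Sₖ ⟩
        ∑[ y ∈ Sₖ ] (if not (onB (suc k) (x , y)) then weight (suc k) (x , y) else 0ℚ)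
          + ∑[ y ∈ Sₖ ] onBWeight (suc k) (x , y)                      ∎)
        where open ≡-Reasoning
      split false = +-nonNeg (∑-nonNeg Sₖ (λ _ → ℚ.≤-refl))
                             (∑-nonNeg Sₖ (λ y → if-nonNeg (onB (suc k) (x , y)) (weight-nonNeg (suc k) (x , y))))

    avoidMass-suc : ∀ k → avoidMass k ≤ℚ avoidMass (suc k) + wB s 𝒜 δ (suc k)
    avoidMass-suc k = begin
      avoidMass k
        ≤⟨ ∑-mono-≤ (allPts s k) (avoidingWeight-fibre k) ⟩
      ∑[ x ∈ allPts s k ] (∑[ y ∈ Sₖ ] avoidingWeight (suc k) (x , y) + ∑[ y ∈ Sₖ ] onBWeight (suc k) (x , y))
        ≡⟨ ∑-+ _ _ (allPts s k) ⟩
      ∑[ x ∈ allPts s k ] ∑[ y ∈ Sₖ ] avoidingWeight (suc k) (x , y)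
        + ∑[ x ∈ allPts s k ] ∑[ y ∈ Sₖ ] onBWeight (suc k) (x , y)
        ≡⟨ cong₂ _+_ (∑-allPts-suc s k (avoidingWeight (suc k))) (∑-allPts-suc s k (onBWeight (suc k))) ⟨
      avoidMass (suc k) + wB s 𝒜 δ (suc k)
        ∎
      where
      open ℚ.≤-Reasoning
      Sₖ : List (Fin (s k))
      Sₖ = allFin (s k)

    avoidMass-bound : ∀ k → 1ℚ ≤ℚ avoidMass k + ∑[ j ∈ upTo k ] wB s 𝒜 δ (suc j)
    avoidMass-bound zero    = ℚ.≤-refl
    avoidMass-bound (suc k) = begin
      1ℚ                                          ≤⟨ avoidMass-bound k ⟩
      avoidMass k + Tₖ                            ≤⟨ ℚ.+-monoˡ-≤ Tₖ (avoidMass-suc k) ⟩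
      avoidMass (suc k) + wB s 𝒜 δ (suc k) + Tₖ    ≡⟨ swap (avoidMass (suc k)) (wB s 𝒜 δ (suc k)) Tₖ ⟩
      avoidMass (suc k) + (Tₖ + wB s 𝒜 δ (suc k))  ≡⟨ cong (avoidMass (suc k) +_) (∑-upTo-suc (λ j → wB s 𝒜 δ (suc j)) k) ⟨
      avoidMass (suc k) + ∑[ j ∈ upTo (suc k) ] wB s 𝒜 δ (suc j) ∎
      where
      open ℚ.≤-Reasoning
      Tₖ : ℚ
      Tₖ = ∑[ j ∈ upTo k ] wB s 𝒜 δ (suc j)
      swap : ∀ a b c → a + b + c ≡ a + (c + b)
      swap = RingSolver.solve-∀ ℚ-ring

    avoiding-point : totalWeight s 𝒜 δ <ℚ 1ℚ → Σ (Pt s n) (λ x → avoidsB n x ≡ true)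
    avoiding-point T<1 =
      let x , 0<weight = ∑-pos⇒∃-pos (allPts s n) (1≤p+q⇒q<1⇒0<p (avoidMass-bound n) T<1)
      in  x , if-pos⇒true (avoidsB n x) 0<weight

  inCore-diag : ∀ k (x : Pt s k) P → inCore s 𝒜 δ k x (k , P) ≡ onHypᵇ s x P
  inCore-diag k x P rewrite ℕ.≟-diag (refl {x = k}) = refl

  onB-strip : ∀ {A k P} {x : Pt s k} → A ∈ 𝒜 → strip s A ≡ (k , P) → _∈H_ s x P → onB k x ≡ true
  onB-strip {A} {k} {P} {x} A∈𝒜 strip≡ x∈P =
    Equivalence.to Bool.T-≡ (any⁺ _ (lose A∈𝒜 (Equivalence.from Bool.T-≡ A-core)))
    where
    A-core : inCore s 𝒜 δ k x (strip s A) ≡ true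
    A-core = trans (cong (inCore s 𝒜 δ k x) strip≡) (trans (inCore-diag k x P) x∈P)

  onHyp⇒avoidsB≡false : ∀ {k A} (x : Pt s k) (H : Hyp s k) → A ∈ 𝒜 → strip s A ≡ strip s H →
                        ¬ AllFree s H → _∈H_ s x H → avoidsB k x ≡ false
  onHyp⇒avoidsB≡false {zero}  tt      tt          _   _      fixed _ = contradiction tt fixed
  onHyp⇒avoidsB≡false {suc k} (x , y) (H , nothing) A∈𝒜 strip≡ fixed x∈H =
    cong (_∧ not (onB (suc k) (x , y))) (onHyp⇒avoidsB≡false x H A∈𝒜 strip≡ fixed x∈H)
  onHyp⇒avoidsB≡false {suc k} (x , y) (H , just c) A∈𝒜 strip≡ _ x∈H = begin
    avoidsB k x ∧ not (onB (suc k) (x , y)) ≡⟨ cong (λ b → avoidsB k x ∧ not b) (onB-strip A∈𝒜 strip≡ x∈H) ⟩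
    avoidsB k x ∧ false                     ≡⟨ Bool.∧-zeroʳ (avoidsB k x) ⟩
    false                                   ∎
    where open ≡-Reasoning

  avoidsB⇒∉ : ∀ {x A} → avoidsB n x ≡ true → A ∈ 𝒜 → ¬ AllFree s A → ¬ _∈H_ s x A
  avoidsB⇒∉ {x} {A} avoids A∈𝒜 fixed x∈A =
    contradiction (trans (sym avoids) (onHyp⇒avoidsB≡false x A A∈𝒜 refl fixed x∈A)) λ ()

lemma2 : (s : ℕ → ℕ) → (∀ j → 2 ≤ s j) →
         (δ : ℕ → ℚ) → (∀ j → (0ℚ ≤ℚ δ j) × (δ j ≤ℚ ½)) →
         (n : ℕ) → (𝒜 : List (Hyp s n)) →
         (∀ A → A ∈ 𝒜 → ¬ AllFree s A) →
         totalWeight s 𝒜 δ <ℚ 1ℚ →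
         Σ (Pt s n) (λ x → ∀ A → A ∈ 𝒜 → ¬ (_∈H_ s x A))
lemma2 s 2≤s δ δ-range n 𝒜 fixed T<1 =
  x , λ A A∈𝒜 → avoidsB⇒∉ avoids A∈𝒜 (fixed A A∈𝒜)
  where
  open Weights s 𝒜 δ (proj₁ ∘ δ-range) (λ j → ℚ.≤-<-trans (proj₂ (δ-range j)) ½<1)
  s≢0 : ∀ j → NonZero (s j)
  s≢0 j = ℕ.>-nonZero (ℕ.≤-trans (ℕ.s≤s ℕ.z≤n) (2≤s j))
  x : Pt s n
  x = proj₁ (avoiding-point s≢0 T<1)
  avoids : avoidsB n x ≡ true
  avoids = proj₂ (avoiding-point s≢0 T<1)
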